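{- Fix an interpretation $f:\{0,1\}\to\{\emptyset,0,1,E\}$ and a bit string $x=x_1\cdots x_t\in\{0,1\}^t$. Let $G$ be the graph on $\{1,\dots,t\}$ where, for $i<s$, $\{i,s\}$ is an edge iff either $f(x_s)=E$, or $f(x_s)\in\{0,1\}$, $i=s-1$ and $x_{s-1}=f(x_s)$. Then $G$ is a threshold graph, or a linear forest, or $K_t$, or $E_t$, or is isomorphic to $E'_{(y)}$ or to $K'_{(y)}$ for some $y\in\{0,1\}^t$.
   Context: This formalizes "fading memory lasting 2 time steps": when vertex $s$ is added with instruction bit $x_s$, the builder can only see the label of vertex $s-1$; it joins $s$ to all earlier vertices ($E$), to none ($\emptyset$), or to vertex $s-1$ exactly when its label equals the specified bit. A threshold graph is obtainable from $K_1$ by repeatedly adding isolated or dominating vertices. A linear forest is a disjoint union of paths (isolated vertices allowed). $K_t$, $E_t$ are the complete and edgeless graphs on $t$ vertices. For $y\in\{0,1\}^t$, with vertex $i$ labelled $y_i$, on vertex set $\{1,\dots,t\}$: $K'_{(y)}$ has all $0$-labelled vertices pairwise adjacent, all $1$-labelled vertices pairwise nonadjacent, and a $0$-labelled $i$ adjacent to a $1$-labelled $j$ iff $i>j$ or $i=j-1$. $E'_{(y)}$ has all $0$-labelled vertices pairwise adjacent, two $1$-labelled vertices $i,j$ adjacent iff $|i-j|=1$, and a $0$-labelled $i$ adjacent to a $1$-labelled $j$ iff $i<j$. -}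

module Defs where

open import Data.Bool using (Bool; true; false; if_then_else_; _∧_; not; _xor_)
open import Data.Nat using (ℕ; suc; _<ᵇ_; _≡ᵇ_; _<_)
open import Data.Fin using (Fin; toℕ)
open import Data.Product using (Σ; ∃; _×_)
open import Function.Bundles using (_↔_; Inverse)
open import Relation.Binary.PropositionalEquality using (_≡_)

-- Bits: false = 0, true = 1.
Bit : Set
Bit = Bool

bitEq : Bit → Bit → Bool
bitEq a b = not (a xor b)

-- A (simple) graph on vertex set {1,…,t}, represented as Fin t
-- (vertex k+1 of the paper is the element of Fin t with toℕ = k),
-- given by a Boolean adjacency function.
Graph : ℕ → Set
Graph t = Fin t → Fin t → Bool

fromLower : ∀ {t} → (Fin t → Fin t → Bool) → Graph t
fromLower R i j =
  if toℕ i <ᵇ toℕ j then R i j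
  else if toℕ j <ᵇ toℕ i then R j i
  else false

consec : ∀ {t} → Fin t → Fin t → Bool
consec i j = suc (toℕ i) ≡ᵇ toℕ j

_≅_ : ∀ {t} → Graph t → Graph t → Set
_≅_ {t} G H = Σ (Fin t ↔ Fin t) λ π →
  ∀ i j → H (Inverse.to π i) (Inverse.to π j) ≡ G i j

-- Possible actions: join to no earlier vertex (∅), join to vertex s-1 iff
-- its label is the given bit, join to all earlier vertices (E).
data Action : Set where
  ∅    : Action
  only : Bit → Action
  E    : Action

builtLower : ∀ {t} → (Bit → Action) → (Fin t → Bit) → Fin t → Fin t → Bool
builtLower f x i s with f (x s)
... | ∅      = false
... | only b = consec i s ∧ bitEq (x i) b
... | E      = true

builtGraph : ∀ {t} → (Bit → Action) → (Fin t → Bit) → Graph t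
builtGraph f x = fromLower (builtLower f x)

K : ∀ t → Graph t
K t = fromLower (λ _ _ → true)

Eₜ : ∀ t → Graph t
Eₜ t = fromLower (λ _ _ → false)

-- Threshold graph built from K_1 by adding vertices 2,…,t in order, vertex j
-- being dominating (d j = true) or isolated (d j = false); d applied to the
-- first vertex is irrelevant.
thresholdBuilt : ∀ {t} → (Fin t → Bool) → Graph t
thresholdBuilt d = fromLower (λ i j → d j)

IsThreshold : ∀ {t} → Graph t → Set
IsThreshold {t} G = (0 < t) × ∃ λ (d : Fin t → Bool) → G ≅ thresholdBuilt d

-- Disjoint union of paths: the paths laid out on consecutive vertices,
-- i.e. the path 1-2-…-t with some edges {i,i+1} removed (c i = false).
pathsUnion : ∀ {t} → (Fin t → Bool) → Graph t
pathsUnion c = fromLower (λ i j → consec i j ∧ c i)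

IsLinearForest : ∀ {t} → Graph t → Set
IsLinearForest {t} G = ∃ λ (c : Fin t → Bool) → G ≅ pathsUnion c

-- K'_(y): 0-vertices pairwise adjacent, 1-vertices pairwise nonadjacent,
-- 0-labelled i adjacent to 1-labelled j iff i > j or i = j - 1.
-- Rule for i < j:
K'lower : ∀ {t} → (Fin t → Bit) → Fin t → Fin t → Bool
K'lower y i j with y i | y j
... | false | false = true
... | true  | true  = false
... | false | true  = consec i j
... | true  | false = true

K' : ∀ {t} → (Fin t → Bit) → Graph t
K' y = fromLower (K'lower y)

-- E'_(y): 0-vertices pairwise adjacent, 1-vertices i,j adjacent iff |i-j|=1,
-- 0-labelled i adjacent to 1-labelled j iff i < j.
E'lower : ∀ {t} → (Fin t → Bit) → Fin t → Fin t → Bool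
E'lower y i j with y i | y j
... | false | false = true
... | true  | true  = consec i j
... | false | true  = true
... | true  | false = false

E' : ∀ {t} → (Fin t → Bit) → Graph t
E' y = fromLower (E'lower y)

module Submission where

-- If neither f 0 nor f 1 is of the form "join the predecessor iff its label is b", every
-- new vertex is isolated or dominating: a threshold graph. If neither is E, edges only join
-- consecutive vertices: a linear forest. Otherwise f c = E for one bit c and the other label
-- joins its predecessor iff that has label b. Relabelling by y = c xor x makes the dominating
-- vertices the 0-vertices; for b = c this is K'_(y) verbatim, and for b ≠ c it is E'_(y) once
-- the vertex order is reversed, which turns "dominates everything earlier" into "adjacent to
-- every later 1-vertex".

open import Defs
open import Data.Nat using (ℕ)
open import Data.Fin using (Fin)
open import Data.Sum using (_⊎_)
open import Data.Product using (∃)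

open import Data.Bool using (Bool; true; false; not; _∧_; _xor_)
open import Data.Bool.Properties using (T-≡; ⇔→≡; ∧-identityʳ; ∧-zeroʳ)
open import Data.Nat using (zero; suc; _<_; _≤_; _∸_; _<ᵇ_; z≤n; s≤s; z<s)
open import Data.Nat.Properties
  using (<⇒<ᵇ; ≡ᵇ⇒≡; ≡⇒≡ᵇ; <-cmp; <⇒≤; ≤-refl; +-∸-assoc; ∸-monoʳ-<)
open import Data.Fin using (zero; suc; toℕ; opposite)
open import Data.Fin.Properties using (toℕ-injective; toℕ<n; opposite-prop; opposite-involutive)
open import Data.Fin.Permutation using (Permutation′; id; reverse)
open import Data.Product using (_,_)
open import Data.Sum using (inj₁; inj₂)
open import Function using (_∘_; _⇔_; mk⇔; Inverse; Equivalence)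
open import Relation.Binary using (tri<; tri≈; tri>)
open import Relation.Binary.PropositionalEquality
open ≡-Reasoning

<⇒<ᵇ≡true : ∀ {m n} → m < n → (m <ᵇ n) ≡ true
<⇒<ᵇ≡true m<n = Equivalence.to T-≡ (<⇒<ᵇ m<n)

≥⇒<ᵇ≡false : ∀ {m n} → n ≤ m → (m <ᵇ n) ≡ false
≥⇒<ᵇ≡false {m}     {zero}  z≤n       = refl
≥⇒<ᵇ≡false {suc m} {suc n} (s≤s n≤m) = ≥⇒<ᵇ≡false n≤m

module _ {t : ℕ} (R : Fin t → Fin t → Bool) where

  fromLower-< : ∀ {i j} → toℕ i < toℕ j → fromLower R i j ≡ R i j
  fromLower-< i<j rewrite <⇒<ᵇ≡true i<j = refl

  fromLower-> : ∀ {i j} → toℕ j < toℕ i → fromLower R i j ≡ R j i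
  fromLower-> j<i rewrite ≥⇒<ᵇ≡false (<⇒≤ j<i) | <⇒<ᵇ≡true j<i = refl

  fromLower-irrefl : ∀ i → fromLower R i i ≡ false
  fromLower-irrefl i rewrite ≥⇒<ᵇ≡false (≤-refl {toℕ i}) = refl

  fromLower-sym : ∀ i j → fromLower R i j ≡ fromLower R j i
  fromLower-sym i j with <-cmp (toℕ i) (toℕ j)
  ... | tri< i<j _ _ = trans (fromLower-< i<j) (sym (fromLower-> i<j))
  ... | tri≈ _ i≡j _ rewrite toℕ-injective i≡j = refl
  ... | tri> _ _ j<i = trans (fromLower-> j<i) (sym (fromLower-< j<i))

-- Both graphs are symmetric and loopless, so it suffices to compare them on pairs i < j.
fromLower-≅ : ∀ {t} {R R' : Fin t → Fin t → Bool} (π : Permutation′ t) →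
  (∀ i j → toℕ i < toℕ j → R i j ≡ fromLower R' (Inverse.to π i) (Inverse.to π j)) →
  fromLower R ≅ fromLower R'
fromLower-≅ {R = R} {R'} π agree = π , matches
  where
  open Inverse π using (to)
  matches : ∀ i j → fromLower R' (to i) (to j) ≡ fromLower R i j
  matches i j with <-cmp (toℕ i) (toℕ j)
  ... | tri< i<j _ _ = trans (sym (agree i j i<j)) (sym (fromLower-< R i<j))
  ... | tri≈ _ i≡j _ rewrite toℕ-injective i≡j =
    trans (fromLower-irrefl R' (to j)) (sym (fromLower-irrefl R j))
  ... | tri> _ _ j<i = begin
    fromLower R' (to i) (to j) ≡⟨ fromLower-sym R' (to i) (to j) ⟩
    fromLower R' (to j) (to i) ≡⟨ agree j i j<i ⟨
    R j i                      ≡⟨ fromLower-> R j<i ⟨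
    fromLower R i j            ∎

fromLower-≅-id : ∀ {t} {R R' : Fin t → Fin t → Bool} →
  (∀ i j → toℕ i < toℕ j → R i j ≡ R' i j) → fromLower R ≅ fromLower R'
fromLower-≅-id {R' = R'} agree =
  fromLower-≅ {R' = R'} id λ i j i<j → trans (agree i j i<j) (sym (fromLower-< R' i<j))

opposite-< : ∀ {t} {i j : Fin t} → toℕ i < toℕ j → toℕ (opposite j) < toℕ (opposite i)
opposite-< {i = i} {j} i<j rewrite opposite-prop i | opposite-prop j =
  ∸-monoʳ-< (s≤s i<j) (toℕ<n j)

fromLower-≅-opposite : ∀ {t} {R R' : Fin t → Fin t → Bool} →
  (∀ i j → toℕ i < toℕ j → R i j ≡ R' (opposite j) (opposite i)) → fromLower R ≅ fromLower R'
fromLower-≅-opposite {R' = R'} agree =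
  fromLower-≅ {R' = R'} reverse λ i j i<j → trans (agree i j i<j) (sym (fromLower-> R' (opposite-< i<j)))

consec≡true⇔ : ∀ {t} (i j : Fin t) → consec i j ≡ true ⇔ suc (toℕ i) ≡ toℕ j
consec≡true⇔ i j = mk⇔
  (≡ᵇ⇒≡ (suc (toℕ i)) (toℕ j) ∘ Equivalence.from T-≡)
  (Equivalence.to T-≡ ∘ ≡⇒≡ᵇ (suc (toℕ i)) (toℕ j))

opposite-consec : ∀ {t} {i j : Fin t} →
  suc (toℕ i) ≡ toℕ j → suc (toℕ (opposite j)) ≡ toℕ (opposite i)
opposite-consec {t} {i} {j} i+1≡j = begin
  suc (toℕ (opposite j))  ≡⟨ cong suc (opposite-prop j) ⟩
  suc (t ∸ suc (toℕ j))   ≡⟨ +-∸-assoc 1 (toℕ<n j) ⟨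
  t ∸ toℕ j               ≡⟨ cong (t ∸_) i+1≡j ⟨
  t ∸ suc (toℕ i)         ≡⟨ opposite-prop i ⟨
  toℕ (opposite i)        ∎

consec-opposite : ∀ {t} (i j : Fin t) → consec (opposite j) (opposite i) ≡ consec i j
consec-opposite i j = ⇔→≡ (mk⇔ reflect preserve)
  where
  preserve : consec i j ≡ true → consec (opposite j) (opposite i) ≡ true
  preserve = Equivalence.from (consec≡true⇔ (opposite j) (opposite i))
    ∘ opposite-consec ∘ Equivalence.to (consec≡true⇔ i j)
  reflect : consec (opposite j) (opposite i) ≡ true → consec i j ≡ true
  reflect = Equivalence.from (consec≡true⇔ i j)
    ∘ subst₂ (λ a b → suc (toℕ a) ≡ toℕ b) (opposite-involutive i) (opposite-involutive j)
    ∘ opposite-consec ∘ Equivalence.to (consec≡true⇔ (opposite j) (opposite i))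

-- The label of vertex i + 1; the value at the last vertex is junk and never used.
nextLabel : ∀ {t} → (Fin t → Bit) → Fin t → Bit
nextLabel {suc zero}    x zero    = false
nextLabel {suc (suc t)} x zero    = x (suc zero)
nextLabel {suc (suc t)} x (suc i) = nextLabel (x ∘ suc) i

nextLabel-consec : ∀ {t} (x : Fin t → Bit) {i j : Fin t} → consec i j ≡ true → nextLabel x i ≡ x j
nextLabel-consec {suc zero}    x {zero}  {zero}        ()
nextLabel-consec {suc (suc t)} x {zero}  {zero}        ()
nextLabel-consec {suc (suc t)} x {zero}  {suc zero}    _  = refl
nextLabel-consec {suc (suc t)} x {zero}  {suc (suc j)} ()
nextLabel-consec {suc (suc t)} x {suc i} {zero}        ()
nextLabel-consec {suc (suc t)} x {suc i} {suc j}       i~j = nextLabel-consec (x ∘ suc) i~j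

isE : Action → Bool
isE E = true
isE _ = false

isOnly : Action → Bool
isOnly (only _) = true
isOnly _        = false

joinsPredecessor : Action → Bit → Bool
joinsPredecessor ∅        _ = false
joinsPredecessor (only b) a = bitEq a b
joinsPredecessor E        _ = true

onBits : ∀ {P : Bit → Set} → P false → P true → ∀ b → P b
onBits p₀ p₁ false = p₀
onBits p₀ p₁ true  = p₁

module _ {t : ℕ} (f : Bit → Action) (x : Fin t → Bit) where

  builtLower-threshold : (∀ b → isOnly (f b) ≡ false) →
    ∀ i j → builtLower f x i j ≡ isE (f (x j))
  builtLower-threshold noOnly i j with f (x j) | noOnly (x j)
  ... | ∅      | _  = refl
  ... | E      | _  = refl
  ... | only _ | ()

  builtLower-local : ∀ {i j} → isE (f (x j)) ≡ false →
    builtLower f x i j ≡ consec i j ∧ joinsPredecessor (f (x j)) (x i)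
  builtLower-local {i} {j} noE with f (x j) | noE
  ... | ∅      | _  = sym (∧-zeroʳ (consec i j))
  ... | only _ | _  = refl
  ... | E      | ()

  builtLower-forest : (∀ b → isE (f b) ≡ false) →
    ∀ i j → builtLower f x i j ≡ consec i j ∧ joinsPredecessor (f (nextLabel x i)) (x i)
  builtLower-forest noE i j rewrite builtLower-local {i} {j} (noE (x j)) with consec i j in i~j
  ... | false = refl
  ... | true  = cong (λ l → joinsPredecessor (f l) (x i)) (sym (nextLabel-consec x i~j))

  builtLower-K' : ∀ c → f c ≡ E → f (not c) ≡ only c →
    ∀ i j → builtLower f x i j ≡ K'lower (λ k → c xor x k) i j
  builtLower-K' false fE fo i j with x i in xᵢ | x j
  ... | false | false rewrite fE = refl
  ... | true  | false rewrite fE = refl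
  ... | false | true  rewrite fo | xᵢ = ∧-identityʳ (consec i j)
  ... | true  | true  rewrite fo | xᵢ = ∧-zeroʳ (consec i j)
  builtLower-K' true fE fo i j with x i in xᵢ | x j
  ... | false | true  rewrite fE = refl
  ... | true  | true  rewrite fE = refl
  ... | false | false rewrite fo | xᵢ = ∧-zeroʳ (consec i j)
  ... | true  | false rewrite fo | xᵢ = ∧-identityʳ (consec i j)

  builtLower-E' : ∀ c → f c ≡ E → f (not c) ≡ only (not c) →
    ∀ i j → builtLower f x i j ≡ E'lower (λ k → c xor x (opposite k)) (opposite j) (opposite i)
  builtLower-E' false fE fo i j
    rewrite opposite-involutive i | opposite-involutive j with x i in xᵢ | x j
  ... | false | false rewrite fE = refl
  ... | true  | false rewrite fE = refl
  ... | false | true  rewrite fo | xᵢ = ∧-zeroʳ (consec i j)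
  ... | true  | true  rewrite fo | xᵢ = trans (∧-identityʳ (consec i j)) (sym (consec-opposite i j))
  builtLower-E' true fE fo i j
    rewrite opposite-involutive i | opposite-involutive j with x i in xᵢ | x j
  ... | false | true  rewrite fE = refl
  ... | true  | true  rewrite fE = refl
  ... | false | false rewrite fo | xᵢ = trans (∧-identityʳ (consec i j)) (sym (consec-opposite i j))
  ... | true  | false rewrite fo | xᵢ = ∧-zeroʳ (consec i j)

  isThreshold : 0 < t → (∀ b → isOnly (f b) ≡ false) → IsThreshold (builtGraph f x)
  isThreshold 0<t noOnly =
    0<t , (λ j → isE (f (x j))) , fromLower-≅-id λ i j _ → builtLower-threshold noOnly i j

  isLinearForest : (∀ b → isE (f b) ≡ false) → IsLinearForest (builtGraph f x)
  isLinearForest noE =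
    (λ i → joinsPredecessor (f (nextLabel x i)) (x i)) ,
    fromLower-≅-id λ i j _ → builtLower-forest noE i j

  ≅K' : ∀ c → f c ≡ E → f (not c) ≡ only c → ∃ λ y → builtGraph f x ≅ K' y
  ≅K' c fE fo = (λ k → c xor x k) , fromLower-≅-id λ i j _ → builtLower-K' c fE fo i j

  ≅E' : ∀ c → f c ≡ E → f (not c) ≡ only (not c) → ∃ λ y → builtGraph f x ≅ E' y
  ≅E' c fE fo = y , fromLower-≅-opposite {R' = E'lower y} λ i j _ → builtLower-E' c fE fo i j
    where
    y : Fin t → Bit
    y k = c xor x (opposite k)

proposition4 : (t : ℕ) (f : Bit → Action) (x : Fin t → Bit) →
    IsThreshold (builtGraph f x)
    ⊎ IsLinearForest (builtGraph f x)
    ⊎ builtGraph f x ≅ K t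
    ⊎ builtGraph f x ≅ Eₜ t
    ⊎ (∃ λ (y : Fin t → Bit) → builtGraph f x ≅ E' y)
    ⊎ (∃ λ (y : Fin t → Bit) → builtGraph f x ≅ K' y)
proposition4 zero f x = inj₂ (inj₂ (inj₁ (fromLower-≅-id λ ())))
proposition4 (suc t) f x with f false in f₀ | f true in f₁
... | ∅      | ∅      = inj₁ (isThreshold f x z<s (onBits (cong isOnly f₀) (cong isOnly f₁)))
... | ∅      | E      = inj₁ (isThreshold f x z<s (onBits (cong isOnly f₀) (cong isOnly f₁)))
... | E      | ∅      = inj₁ (isThreshold f x z<s (onBits (cong isOnly f₀) (cong isOnly f₁)))
... | E      | E      = inj₁ (isThreshold f x z<s (onBits (cong isOnly f₀) (cong isOnly f₁)))
... | ∅      | only _ = inj₂ (inj₁ (isLinearForest f x (onBits (cong isE f₀) (cong isE f₁))))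
... | only _ | ∅      = inj₂ (inj₁ (isLinearForest f x (onBits (cong isE f₀) (cong isE f₁))))
... | only _ | only _ = inj₂ (inj₁ (isLinearForest f x (onBits (cong isE f₀) (cong isE f₁))))
... | E          | only false = inj₂ (inj₂ (inj₂ (inj₂ (inj₂ (≅K' f x false f₀ f₁)))))
... | only true  | E          = inj₂ (inj₂ (inj₂ (inj₂ (inj₂ (≅K' f x true f₁ f₀)))))
... | E          | only true  = inj₂ (inj₂ (inj₂ (inj₂ (inj₁ (≅E' f x false f₀ f₁)))))
... | only false | E          = inj₂ (inj₂ (inj₂ (inj₂ (inj₁ (≅E' f x true f₁ f₀)))))
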